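{- Let $k\geq 2$ be an even integer and define, for integers $m$, \[ f(k,m)=\begin{cases}\binom{m}{m/2}\binom{k-m-1}{(k-m)/2} & \text{if } m \text{ is even and } 0\leq m\leq k-2,\\ 0 & \text{otherwise.}\end{cases} \] Then: (1) for every even $m$ with $0<m<k$, $f(k,m)=f(k,k-m)$; (2) $f(k,m)$ is strictly decreasing in $m$ over even $m$ with $0\leq m\leq k/2$; (3) $f(k,0)=\binom{k-1}{k/2-1}=\binom{k-1}{k/2}$; (4) $f(k,0)\geq f(k,k-2)=f(k,2)\geq f(k,k-4)=f(k,4)\geq\cdots$, i.e. for every even $m\geq 0$ with $m+2\leq k/2$ one has $f(k,m)\geq f(k,k-m-2)=f(k,m+2)$. -}

module Defs where

open import Data.Nat using (ℕ; _∸_; _*_; _≤?_)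
open import Data.Nat.DivMod using (_/_)
open import Data.Nat.Divisibility using (_∣?_)
open import Data.Nat.Combinatorics using (_C_)
open import Relation.Nullary using (yes; no)

-- f(k,m) = C(m, m/2) * C(k-m-1, (k-m)/2)  if m even and 0 ≤ m ≤ k-2, else 0.
-- (m ranges over ℕ; negative integers m give 0 and are never used by the claims.)
f : ℕ → ℕ → ℕ
f k m with 2 ∣? m | m ≤? k ∸ 2
... | yes _ | yes _ = (m C (m / 2)) * ((k ∸ m ∸ 1) C ((k ∸ m) / 2))
... | _     | _     = 0

module Submission where

-- Write k = 2n and m = 2a.  For 0 ≤ a < n the definition of f unfolds to
--
--     f (2n) (2a) = central a * oddCentral c,     where a + 1 + c = n,
--
-- with  central a = C(2a, a)  and  oddCentral c = C(2c+1, c+1).  All four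
-- claims are statements about these two sequences of binomial coefficients:
--
--   * Pascal's rule gives  central (c+1) = 2 * oddCentral c,  so the product
--     central (a+1) * oddCentral c = 2 * oddCentral a * oddCentral c is
--     symmetric in a and c; this is claim (1).
--   * The absorption identity  (k+1) C(n+1, k+1) = (n+1) C(n, k)  gives the
--     ratios of consecutive terms of both sequences.  Cross-multiplying, one
--     step m ↦ m + 2 strictly decreases f as long as m + 2 ≤ k/2; iterating
--     gives claim (2).
--   * Claim (3) is the case a = 0 together with the symmetry of C(2c+1, -).
--   * Claim (4) is claim (1) at m + 2 combined with claim (2).

open import Defs
open import Data.Nat using (ℕ; _+_; _∸_; _≤_; _<_; _>_; _≥_)
open import Data.Nat.DivMod using (_/_)
open import Data.Nat.Divisibility using (_∣_)
open import Data.Nat.Combinatorics using (_C_)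
open import Data.Product using (_×_)
open import Relation.Binary.PropositionalEquality using (_≡_)

open import Data.Nat using (zero; suc; _*_; z≤n; s≤s; z<s; NonZero; >-nonZero; _≤?_)
open import Data.Nat.Properties
open import Data.Nat.DivMod using (m*n/n≡m)
open import Data.Nat.Divisibility using (divides; _∣?_; ∣m∣n⇒∣m+n)
open import Data.Nat.Combinatorics
  using (nCk≡nC[n∸k]; nC1≡n; nCk+nC[k+1]≡[n+1]C[k+1])
open import Data.Nat.Tactic.RingSolver using (solve-∀)
open import Data.Product using (_,_)
open import Data.Sum using (inj₁; inj₂)
open import Relation.Nullary using (yes; no; contradiction)
open import Relation.Binary.PropositionalEquality
  using (refl; sym; trans; cong; cong₂; subst; subst₂; module ≡-Reasoning)
open ≡-Reasoning

pascal : ∀ n k → suc n C suc k ≡ n C k + n C suc k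
pascal n k = sym (nCk+nC[k+1]≡[n+1]C[k+1] n k)

C-pos : ∀ {n k} → k ≤ n → 0 < n C k
C-pos {k = zero} _ = z<s
C-pos {suc n} {suc k} (s≤s k≤n) =
  subst (0 <_) (sym (pascal n k)) (≤-trans (C-pos k≤n) (m≤m+n (n C k) (n C suc k)))

absorption : ∀ n k → suc k * (suc n C suc k) ≡ suc n * (n C k)
absorption zero    zero    = refl
absorption zero    (suc k) = *-zeroʳ (suc (suc k))
absorption (suc n) zero    = trans (+-identityʳ _) (trans (nC1≡n (suc (suc n))) (sym (*-identityʳ _)))
absorption (suc n) (suc k) = begin
    suc K * (suc N C suc K)                      ≡⟨ cong (suc K *_) (pascal N K) ⟩
    suc K * (N C K + N C suc K)                  ≡⟨ *-distribˡ-+ (suc K) (N C K) (N C suc K) ⟩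
    (N C K + K * (N C K)) + suc K * (N C suc K)  ≡⟨ cong₂ (λ x y → (N C K + x) + y) (absorption n k) (absorption n K) ⟩
    (N C K + N * (n C k)) + N * (n C K)          ≡⟨ +-assoc (N C K) (N * (n C k)) (N * (n C K)) ⟩
    N C K + (N * (n C k) + N * (n C K))          ≡⟨ cong (N C K +_) (sym (*-distribˡ-+ N (n C k) (n C K))) ⟩
    N C K + N * (n C k + n C K)                  ≡⟨ cong (λ x → N C K + N * x) (sym (pascal n k)) ⟩
    suc N * (N C K)                              ∎
  where
  N K : ℕ
  N = suc n
  K = suc k

central : ℕ → ℕ
central a = (a * 2) C a

oddCentral : ℕ → ℕ
oddCentral c = suc (c * 2) C suc c

oddCentral-sym : ∀ c → suc (c * 2) C c ≡ oddCentral c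
oddCentral-sym c = trans (nCk≡nC[n∸k] c≤2c+1) (cong (suc (c * 2) C_) complement)
  where
  c≤2c+1 : c ≤ suc (c * 2)
  c≤2c+1 = ≤-trans (m≤m*n c 2) (n≤1+n (c * 2))
  odd-split : ∀ c → suc (c * 2) ≡ c + suc c
  odd-split = solve-∀
  complement : suc (c * 2) ∸ c ≡ suc c
  complement = trans (cong (_∸ c) (odd-split c)) (m+n∸m≡n c (suc c))

central≡2*oddCentral : ∀ c → central (suc c) ≡ 2 * oddCentral c
central≡2*oddCentral c = begin
  central (suc c)                              ≡⟨ pascal (suc (c * 2)) c ⟩
  suc (c * 2) C c + oddCentral c               ≡⟨ cong (_+ oddCentral c) (oddCentral-sym c) ⟩
  oddCentral c + oddCentral c                  ≡⟨ cong (oddCentral c +_) (sym (+-identityʳ (oddCentral c))) ⟩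
  2 * oddCentral c                             ∎

central-ratio : ∀ a → suc a * central (suc a) ≡ (2 * suc (a * 2)) * central a
central-ratio a = begin
  suc a * central (suc a)                ≡⟨ cong (suc a *_) (central≡2*oddCentral a) ⟩
  suc a * (2 * oddCentral a)             ≡⟨ x*[2*y]≡2*[x*y] (suc a) (oddCentral a) ⟩
  2 * (suc a * oddCentral a)             ≡⟨ cong (2 *_) (absorption (a * 2) a) ⟩
  2 * (suc (a * 2) * central a)          ≡⟨ sym (*-assoc 2 (suc (a * 2)) (central a)) ⟩
  (2 * suc (a * 2)) * central a          ∎
  where
  x*[2*y]≡2*[x*y] : ∀ x y → x * (2 * y) ≡ 2 * (x * y)
  x*[2*y]≡2*[x*y] = solve-∀

oddCentral-ratio : ∀ c → suc (suc c) * oddCentral (suc c) ≡ (2 * suc (suc c * 2)) * oddCentral c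
oddCentral-ratio c = begin
  suc (suc c) * oddCentral (suc c)       ≡⟨ absorption (suc c * 2) (suc c) ⟩
  suc (suc c * 2) * central (suc c)      ≡⟨ cong (suc (suc c * 2) *_) (central≡2*oddCentral c) ⟩
  suc (suc c * 2) * (2 * oddCentral c)   ≡⟨ x*[2*y]≡[2*x]*y (suc (suc c * 2)) (oddCentral c) ⟩
  (2 * suc (suc c * 2)) * oddCentral c   ∎
  where
  x*[2*y]≡[2*x]*y : ∀ x y → x * (2 * y) ≡ (2 * x) * y
  x*[2*y]≡[2*x]*y = solve-∀

product-pos : ∀ a c → 0 < central a * oddCentral c
product-pos a c = *-mono-< (C-pos (m≤m*n a 2)) (C-pos (s≤s (m≤m*n c 2)))

product-symmetric : ∀ a c → central (suc a) * oddCentral c ≡ central (suc c) * oddCentral a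
product-symmetric a c = begin
  central (suc a) * oddCentral c         ≡⟨ cong (_* oddCentral c) (central≡2*oddCentral a) ⟩
  2 * oddCentral a * oddCentral c        ≡⟨ [2*x]*y≡[2*y]*x (oddCentral a) (oddCentral c) ⟩
  2 * oddCentral c * oddCentral a        ≡⟨ cong (_* oddCentral a) (sym (central≡2*oddCentral c)) ⟩
  central (suc c) * oddCentral a         ∎
  where
  [2*x]*y≡[2*y]*x : ∀ x y → 2 * x * y ≡ 2 * y * x
  [2*x]*y≡[2*y]*x = solve-∀

-- Ratio test for products: if p′ = (u/s) p and q′ = (v/t) q with u/s < v/t
-- (cross-multiplied), and pq > 0, then p′q < pq′.
ratio-compare : ∀ {p p′ q q′} s t u v → s * p′ ≡ u * p → t * q′ ≡ v * q →
                u * t < s * v → 0 < p * q → p′ * q < p * q′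
ratio-compare {p} {p′} {q} {q′} s t u v p-ratio q-ratio u/s<v/t pq>0 =
  *-cancelˡ-< (s * t) (p′ * q) (p * q′) (subst₂ _<_ (sym scaled-left) (sym scaled-right) scaled<)
  where
  instance
    pq≢0 : NonZero (p * q)
    pq≢0 = >-nonZero pq>0
  scaled< : u * t * (p * q) < s * v * (p * q)
  scaled< = *-monoˡ-< (p * q) u/s<v/t
  scaled-left : s * t * (p′ * q) ≡ u * t * (p * q)
  scaled-left = begin
    s * t * (p′ * q)   ≡⟨ regroup-left s t p′ q ⟩
    (s * p′) * t * q   ≡⟨ cong (λ x → x * t * q) p-ratio ⟩
    (u * p) * t * q    ≡⟨ regroup-left′ u p t q ⟩
    u * t * (p * q)    ∎
    where
    regroup-left : ∀ s t p′ q → s * t * (p′ * q) ≡ (s * p′) * t * q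
    regroup-left = solve-∀
    regroup-left′ : ∀ u p t q → (u * p) * t * q ≡ u * t * (p * q)
    regroup-left′ = solve-∀
  scaled-right : s * t * (p * q′) ≡ s * v * (p * q)
  scaled-right = begin
    s * t * (p * q′)   ≡⟨ regroup-right s t p q′ ⟩
    s * p * (t * q′)   ≡⟨ cong (s * p *_) q-ratio ⟩
    s * p * (v * q)    ≡⟨ regroup-right′ s p v q ⟩
    s * v * (p * q)    ∎
    where
    regroup-right : ∀ s t p q′ → s * t * (p * q′) ≡ s * p * (t * q′)
    regroup-right = solve-∀
    regroup-right′ : ∀ s p v q → s * p * (v * q) ≡ s * v * (p * q)
    regroup-right′ = solve-∀

-- The numerical inequality behind the decrease: for a ≤ c (written c = a + d),
-- 2(2a+1)(c+2) < (a+1) 2(2c+3); indeed the difference is 2(d+1).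
ratio-gap : ∀ a d → (2 * suc (a * 2)) * suc (suc (a + d)) < suc a * (2 * suc (suc (a + d) * 2))
ratio-gap a d = subst (lhs <_) (sym (gap a d)) (m<m+n lhs z<s)
  where
  lhs : ℕ
  lhs = (2 * suc (a * 2)) * suc (suc (a + d))
  gap : ∀ a d → suc a * (2 * suc (suc (a + d) * 2)) ≡ (2 * suc (a * 2)) * suc (suc (a + d)) + 2 * suc d
  gap = solve-∀

product-step : ∀ a d → central (suc a) * oddCentral (a + d) < central a * oddCentral (suc (a + d))
product-step a d =
  ratio-compare (suc a) (suc (suc (a + d))) (2 * suc (a * 2)) (2 * suc (suc (a + d) * 2))
    (central-ratio a) (oddCentral-ratio (a + d)) (ratio-gap a d) (product-pos a (a + d))

double-difference : ∀ a b → (a + b) * 2 ∸ a * 2 ≡ b * 2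
double-difference a b = trans (cong (_∸ a * 2) (*-distribʳ-+ 2 a b)) (m+n∸m≡n (a * 2) (b * 2))

f-even : ∀ {n} a c → a + suc c ≡ n → f (n * 2) (a * 2) ≡ central a * oddCentral c
f-even a c refl with 2 ∣? (a * 2) | a * 2 ≤? (a + suc c) * 2 ∸ 2
... | yes _ | yes _ = cong₂ _*_ (cong ((a * 2) C_) (m*n/n≡m a 2)) (cong₂ _C_ top bottom)
  where
  top : (a + suc c) * 2 ∸ a * 2 ∸ 1 ≡ suc (c * 2)
  top = cong (_∸ 1) (double-difference a (suc c))
  bottom : ((a + suc c) * 2 ∸ a * 2) / 2 ≡ suc c
  bottom = trans (cong (_/ 2) (double-difference a (suc c))) (m*n/n≡m (suc c) 2)
... | no 2∤2a | _     = contradiction (divides a refl) 2∤2a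
... | yes _   | no 2a≰ = contradiction in-range 2a≰
  where
  in-range : a * 2 ≤ (a + suc c) * 2 ∸ 2
  in-range = subst (λ x → a * 2 ≤ x * 2 ∸ 2) (sym (+-suc a c)) (*-monoˡ-≤ 2 (m≤m+n a c))

f-symmetric : ∀ {n} a c → suc a + suc c ≡ n → f (n * 2) (suc a * 2) ≡ f (n * 2) (suc c * 2)
f-symmetric a c split = begin
  f _ (suc a * 2)                      ≡⟨ f-even (suc a) c split ⟩
  central (suc a) * oddCentral c       ≡⟨ product-symmetric a c ⟩
  central (suc c) * oddCentral a       ≡⟨ sym (f-even (suc c) a (trans (+-comm (suc c) (suc a)) split)) ⟩
  f _ (suc c * 2)                      ∎

f-step : ∀ n a → suc a * 2 ≤ n → f (n * 2) (suc a * 2) < f (n * 2) (a * 2)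
f-step n a h with m≤n⇒∃[o]m+o≡n h
... | d , refl = subst₂ _<_ (sym (f-even (suc a) (a + d) (split₁ a d))) (sym (f-even a (suc (a + d)) (split₂ a d)))
                   (product-step a d)
  where
  split₁ : ∀ a d → suc a + suc (a + d) ≡ suc a * 2 + d
  split₁ = solve-∀
  split₂ : ∀ a d → a + suc (suc (a + d)) ≡ suc a * 2 + d
  split₂ = solve-∀

f-decreasing : ∀ n a b → a < b → b * 2 ≤ n → f (n * 2) (b * 2) < f (n * 2) (a * 2)
f-decreasing n a (suc b) (s≤s a≤b) h with m≤n⇒m<n∨m≡n a≤b
... | inj₂ refl = f-step n a h
... | inj₁ a<b  = <-trans (f-step n b h) (f-decreasing n a b a<b (≤-trans (*-monoˡ-≤ 2 (n≤1+n b)) h))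

f-at-zero : ∀ c → f (suc c * 2) 0 ≡ oddCentral c
f-at-zero c = trans (f-even 0 c refl) (*-identityˡ (oddCentral c))

half : ∀ n → n * 2 / 2 ≡ n
half n = m*n/n≡m n 2

n<n*2 : ∀ {n} → 0 < n → n < n * 2
n<n*2 {suc n} _ = m<m*n (suc n) 2 (s≤s (s≤s z≤n))

claim-symmetry : ∀ n m → 2 ∣ m → 0 < m → m < n * 2 → f (n * 2) m ≡ f (n * 2) (n * 2 ∸ m)
claim-symmetry n .0 (divides zero refl) () _
claim-symmetry n .(suc a * 2) (divides (suc a) refl) _ m<k = begin
    f (n * 2) (suc a * 2)           ≡⟨ f-symmetric a c split ⟩
    f (n * 2) (suc c * 2)           ≡⟨ cong (f (n * 2)) (sym complement) ⟩
    f (n * 2) (n * 2 ∸ suc a * 2)   ∎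
  where
  a+1<n : suc a < n
  a+1<n = *-cancelʳ-< 2 (suc a) n m<k
  c : ℕ
  c = n ∸ suc (suc a)
  split : suc a + suc c ≡ n
  split = trans (+-suc (suc a) c) (m+[n∸m]≡n a+1<n)
  complement : n * 2 ∸ suc a * 2 ≡ suc c * 2
  complement = trans (cong (λ x → x * 2 ∸ suc a * 2) (sym split)) (double-difference (suc a) (suc c))

claim-decreasing : ∀ n m m′ → 2 ∣ m → 2 ∣ m′ → m < m′ → m′ ≤ n * 2 / 2 → f (n * 2) m > f (n * 2) m′
claim-decreasing n .(a * 2) .(b * 2) (divides a refl) (divides b refl) m<m′ m′≤n =
  f-decreasing n a b (*-cancelʳ-< 2 a b m<m′) (subst (b * 2 ≤_) (half n) m′≤n)

claim-at-zero : ∀ n → 2 ≤ n * 2 → (f (n * 2) 0 ≡ (n * 2 ∸ 1) C (n * 2 / 2 ∸ 1)) × (f (n * 2) 0 ≡ (n * 2 ∸ 1) C (n * 2 / 2))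
claim-at-zero (suc c) _ =
    trans (f-at-zero c) (trans (sym (oddCentral-sym c)) (cong (λ x → suc (c * 2) C (x ∸ 1)) (sym (half (suc c)))))
  , trans (f-at-zero c) (cong (suc (c * 2) C_) (sym (half (suc c))))

claim-paired : ∀ n m → 2 ∣ m → m + 2 ≤ n * 2 / 2 → (f (n * 2) m ≥ f (n * 2) (n * 2 ∸ m ∸ 2)) × (f (n * 2) (n * 2 ∸ m ∸ 2) ≡ f (n * 2) (m + 2))
claim-paired n m 2∣m m+2≤k/2 = subst (_≤ f (n * 2) m) (sym mirror) (<⇒≤ decrease) , mirror
  where
  2∣m+2 : 2 ∣ m + 2
  2∣m+2 = ∣m∣n⇒∣m+n 2∣m (divides 1 refl)
  0<m+2 : 0 < m + 2
  0<m+2 = <-≤-trans z<s (m≤n+m 2 m)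
  m+2<k : m + 2 < n * 2
  m+2<k = <-≤-trans (n<n*2 0<m+2) (*-monoˡ-≤ 2 (subst (m + 2 ≤_) (half n) m+2≤k/2))
  mirror : f (n * 2) (n * 2 ∸ m ∸ 2) ≡ f (n * 2) (m + 2)
  mirror = trans (cong (f (n * 2)) (∸-+-assoc (n * 2) m 2)) (sym (claim-symmetry n (m + 2) 2∣m+2 0<m+2 m+2<k))
  decrease : f (n * 2) m > f (n * 2) (m + 2)
  decrease = claim-decreasing n m (m + 2) 2∣m 2∣m+2 (m<m+n m z<s) m+2≤k/2

proposition3p2 : (k : ℕ) → 2 ≤ k → 2 ∣ k →
    ((m : ℕ) → 2 ∣ m → 0 < m → m < k → f k m ≡ f k (k ∸ m))
    × ((m m′ : ℕ) → 2 ∣ m → 2 ∣ m′ → m < m′ → m′ ≤ k / 2 → f k m > f k m′)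
    × (f k 0 ≡ (k ∸ 1) C (k / 2 ∸ 1) × f k 0 ≡ (k ∸ 1) C (k / 2))
    × ((m : ℕ) → 2 ∣ m → m + 2 ≤ k / 2 → (f k m ≥ f k (k ∸ m ∸ 2)) × (f k (k ∸ m ∸ 2) ≡ f k (m + 2)))
proposition3p2 .(n * 2) 2≤k (divides n refl) =
  claim-symmetry n , claim-decreasing n , claim-at-zero n 2≤k , claim-paired n
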